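{- (Soundness of access Hoare logic.) For every program $C$ of the while language and all assertions $P,Q$: if $\langle P\rangle\,C\,\langle Q\rangle$ is provable in access Hoare logic, then $\langle P\rangle\,C\,\langle Q\rangle$ is valid.
   Context: States are mappings from variables to values; assertions are predicates on states. Programs of the while language are built from $\mathtt{skip}$, assignments $V:=E$ ($V$ a variable, $E$ a side-effect-free expression possibly containing $V$), sequential composition $S;T$, $\mathtt{if}\ B\ \mathtt{then}\ S\ \mathtt{else}\ T$ and $\mathtt{while}\ B\ \mathtt{do}\ S$ ($B$ a boolean condition), with the standard deterministic big-step execution relation $C:s\Rightarrow s'$. The access Hoare triple $\langle P\rangle\,C\,\langle Q\rangle$ is valid iff $\forall s,s'\,[\,C:s\Rightarrow s'\wedge Q(s')\rightarrow P(s)\,]$. Access Hoare logic is the calculus with the following axioms and rules: (skip) $\langle P\rangle\,\mathtt{skip}\,\langle P\rangle$; (assignment) $\langle P[E/V]\rangle\,V:=E\,\langle P\rangle$, where $P[E/V]$ replaces free occurrences of $V$ in $P$ by $E$; (consequence) from $P_2\rightarrow P_1$ (valid implication), $\langle P_2\rangle\,S\,\langle Q_2\rangle$ and $Q_1\rightarrow Q_2$ (valid implication) infer $\langle P_1\rangle\,S\,\langle Q_1\rangle$; (composition) from $\langle P\rangle\,S\,\langle R\rangle$ and $\langle R\rangle\,T\,\langle Q\rangle$ infer $\langle P\rangle\,S;T\,\langle Q\rangle$; (conditional) from $\langle B\rightarrow P\rangle\,S\,\langle Q\rangle$ and $\langle \neg B\rightarrow P\rangle\,T\,\langle Q\rangle$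 infer $\langle P\rangle\,\mathtt{if}\ B\ \mathtt{then}\ S\ \mathtt{else}\ T\,\langle Q\rangle$; (while) from $\langle B\rightarrow P\rangle\,S\,\langle P\rangle$ infer $\langle P\rangle\,\mathtt{while}\ B\ \mathtt{do}\ S\,\langle \neg B\rightarrow P\rangle$. -}

module Defs where

open import Data.Bool using (Bool; true; false)
open import Relation.Nullary using (¬_; yes; no)
open import Relation.Binary.Definitions using (DecidableEquality)
open import Relation.Binary.PropositionalEquality using (_≡_)

-- Expressions and boolean
-- conditions are side-effect-free, hence modelled as functions of the state.
module WhileLang (Var : Set) (_≟V_ : DecidableEquality Var) (Val : Set) where

  State : Set
  State = Var → Val

  Expr : Set
  Expr = State → Val

  BExpr : Set
  BExpr = State → Bool

  Assertion : Set₁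
  Assertion = State → Set

  update : State → Var → Val → State
  update s V v W with W ≟V V
  ... | yes _ = v
  ... | no  _ = s W

  data Cmd : Set where
    skip   : Cmd
    _:=_   : Var → Expr → Cmd
    _︔_    : Cmd → Cmd → Cmd
    ifc_then_else_ : BExpr → Cmd → Cmd → Cmd
    while_do′_ : BExpr → Cmd → Cmd

  data _∶_⇒_ : Cmd → State → State → Set where
    ⇒skip   : ∀ {s} → skip ∶ s ⇒ s
    ⇒assign : ∀ {s V E} → (V := E) ∶ s ⇒ update s V (E s)
    ⇒seq    : ∀ {S T s s' s''} → S ∶ s ⇒ s' → T ∶ s' ⇒ s'' → (S ︔ T) ∶ s ⇒ s''
    ⇒ifT    : ∀ {B S T s s'} → B s ≡ true → S ∶ s ⇒ s' → (ifc B then S else T) ∶ s ⇒ s'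
    ⇒ifF    : ∀ {B S T s s'} → B s ≡ false → T ∶ s ⇒ s' → (ifc B then S else T) ∶ s ⇒ s'
    ⇒whileF : ∀ {B S s} → B s ≡ false → (while B do′ S) ∶ s ⇒ s
    ⇒whileT : ∀ {B S s s' s''} → B s ≡ true → S ∶ s ⇒ s' → (while B do′ S) ∶ s' ⇒ s''
              → (while B do′ S) ∶ s ⇒ s''

  _⇒ᵃ_ : Assertion → Assertion → Assertion
  (P ⇒ᵃ Q) s = P s → Q s

  holds : BExpr → Assertion
  holds B s = B s ≡ true

  notᵃ : Assertion → Assertion
  notᵃ P s = ¬ P s

  Valid⇒ : Assertion → Assertion → Set
  Valid⇒ P Q = ∀ s → P s → Q s

  _[_/_] : Assertion → Expr → Var → Assertion
  (P [ E / V ]) s = P (update s V (E s))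

  ValidAccess : Assertion → Cmd → Assertion → Set
  ValidAccess P C Q = ∀ s s' → C ∶ s ⇒ s' → Q s' → P s

  data ⊢⟨_⟩_⟨_⟩ : Assertion → Cmd → Assertion → Set₁ where
    skipR  : ∀ {P} → ⊢⟨ P ⟩ skip ⟨ P ⟩
    assnR  : ∀ {P V E} → ⊢⟨ P [ E / V ] ⟩ (V := E) ⟨ P ⟩
    consR  : ∀ {P₁ P₂ Q₁ Q₂ S} → Valid⇒ P₂ P₁ → ⊢⟨ P₂ ⟩ S ⟨ Q₂ ⟩ → Valid⇒ Q₁ Q₂
             → ⊢⟨ P₁ ⟩ S ⟨ Q₁ ⟩
    compR  : ∀ {P Q R S T} → ⊢⟨ P ⟩ S ⟨ R ⟩ → ⊢⟨ R ⟩ T ⟨ Q ⟩ → ⊢⟨ P ⟩ (S ︔ T) ⟨ Q ⟩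
    condR  : ∀ {P Q B S T} → ⊢⟨ holds B ⇒ᵃ P ⟩ S ⟨ Q ⟩ → ⊢⟨ notᵃ (holds B) ⇒ᵃ P ⟩ T ⟨ Q ⟩
             → ⊢⟨ P ⟩ (ifc B then S else T) ⟨ Q ⟩
    whileR : ∀ {P B S} → ⊢⟨ holds B ⇒ᵃ P ⟩ S ⟨ P ⟩
             → ⊢⟨ P ⟩ (while B do′ S) ⟨ notᵃ (holds B) ⇒ᵃ P ⟩

-- For the while rule the invariant P is pulled
-- back from the exit state through every iteration, by induction on the execution.
module Submission where

open import Defs
open import Data.Bool using (Bool; true; false)
open import Relation.Binary.Definitions using (DecidableEquality)
open import Relation.Binary.PropositionalEquality using (_≡_; refl)
open import Relation.Nullary using (¬_)

false⇒¬true : ∀ {b : Bool} → b ≡ false → ¬ b ≡ true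
false⇒¬true refl ()

module AccessHoareSoundness (Var : Set) (_≟V_ : DecidableEquality Var) (Val : Set) where
  open WhileLang Var _≟V_ Val

  valid-skip : ∀ {P} → ValidAccess P skip P
  valid-skip s .s ⇒skip Ps = Ps

  valid-assign : ∀ {P V E} → ValidAccess (P [ E / V ]) (V := E) P
  valid-assign s _ ⇒assign Ps' = Ps'

  valid-cons : ∀ {P₁ P₂ Q₁ Q₂ S} → Valid⇒ P₂ P₁ → ValidAccess P₂ S Q₂ → Valid⇒ Q₁ Q₂
             → ValidAccess P₁ S Q₁
  valid-cons P₂⇒P₁ ⊨S Q₁⇒Q₂ s s' S⇒ Q₁s' = P₂⇒P₁ s (⊨S s s' S⇒ (Q₁⇒Q₂ s' Q₁s'))

  valid-seq : ∀ {P Q R S T} → ValidAccess P S R → ValidAccess R T Q → ValidAccess P (S ︔ T) Q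
  valid-seq ⊨S ⊨T s s'' (⇒seq S⇒ T⇒) Qs'' = ⊨S s _ S⇒ (⊨T _ s'' T⇒ Qs'')

  valid-if : ∀ {P Q B S T} → ValidAccess (holds B ⇒ᵃ P) S Q
           → ValidAccess (notᵃ (holds B) ⇒ᵃ P) T Q
           → ValidAccess P (ifc B then S else T) Q
  valid-if ⊨S ⊨T s s' (⇒ifT Bs S⇒) Qs' = ⊨S s s' S⇒ Qs' Bs
  valid-if ⊨S ⊨T s s' (⇒ifF Bs T⇒) Qs' = ⊨T s s' T⇒ Qs' (false⇒¬true Bs)

  valid-while : ∀ {P B S} → ValidAccess (holds B ⇒ᵃ P) S P
              → ValidAccess P (while B do′ S) (notᵃ (holds B) ⇒ᵃ P)
  valid-while ⊨S s .s (⇒whileF Bs) exit = exit (false⇒¬true Bs)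
  valid-while ⊨S s s'' (⇒whileT Bs S⇒ loop⇒) exit =
    ⊨S s _ S⇒ (valid-while ⊨S _ s'' loop⇒ exit) Bs

  sound : ∀ {P C Q} → ⊢⟨ P ⟩ C ⟨ Q ⟩ → ValidAccess P C Q
  sound skipR             = valid-skip
  sound assnR             = valid-assign
  sound (consR P⇒ ⊢S ⇒Q)  = valid-cons P⇒ (sound ⊢S) ⇒Q
  sound (compR ⊢S ⊢T)     = valid-seq (sound ⊢S) (sound ⊢T)
  sound (condR ⊢S ⊢T)     = valid-if (sound ⊢S) (sound ⊢T)
  sound (whileR ⊢S)       = valid-while (sound ⊢S)

theorem6p1 : (Var : Set) (_≟V_ : DecidableEquality Var) (Val : Set)
    → let open WhileLang Var _≟V_ Val in
    (C : Cmd) (P Q : Assertion) → ⊢⟨ P ⟩ C ⟨ Q ⟩ → ValidAccess P C Q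
theorem6p1 Var _≟V_ Val C P Q = AccessHoareSoundness.sound Var _≟V_ Val
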